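{- Let $T\in\mathcal F$ be a trigraph with no balanced skew-partition and non-negative real weights on its vertices, and let $(A_1,B_1,C_1,A_2,B_2,C_2)$ be a split of an odd $2$-join $(X_1,X_2)$ of $T$. Then $\alpha_C+\alpha_X\le\alpha_{AC}+\alpha_{BC}$, where $\alpha_{AC}=\alpha(T|(A_1\cup C_1))$, $\alpha_{BC}=\alpha(T|(B_1\cup C_1))$, $\alpha_C=\alpha(T|C_1)$ and $\alpha_X=\alpha(T|X_1)$.
   Context: Trigraphs: finite $V(T)$ with $\theta:\binom{V(T)}{2}\to\{ -1,0,1\}$; $u,v$ strongly adjacent if $\theta(uv)=1$, strongly antiadjacent if $-1$, a switchable pair if $0$; adjacent if $\theta\in\{0,1\}$, antiadjacent if $\theta\in\{ -1,0\}$. Complement: $-\theta$; $T|X$: induced trigraph. Full realization: graph of adjacent pairs. Connected/anticonnected sets: full realization of $T|X$ connected / complement of the graph on $X$ of strongly adjacent pairs connected; components = maximal connected subsets. Path: distinct $p_1,\dots,p_k$, consecutive adjacent, non-consecutive antiadjacent (length $k-1$, interior = inner vertices); hole: $h_1,\dots,h_k$, $k\ge4$, $h_i,h_j$ adjacent iff $|i-j|\in\{1,k-1\}$, else antiadjacent; antipath/antihole: complement is a path/hole of $\overline T$. Berge: no odd hole, no odd antihole. Skew-partition: partition $(A,B)$, $A$ not connected, $B$ not anticonnected; balanced if no path of odd length $>1$ with ends in $B$ and interior in $A$ and no antipath of odd length $>1$ with ends in $A$ and interior in $B$. $\mathcal F$: Berge trigraphs where each component of the graph $\Sigma(T)$ of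 switchable pairs has at most two edges and each vertex $v$ of $\Sigma(T)$-degree two with $\Sigma(T)$-neighbours $x,y$ is either strongly adjacent to all of $V(T)\setminus\{v,x,y\}$ with $xy$ strongly adjacent, or strongly antiadjacent to all of $V(T)\setminus\{v,x,y\}$ with $xy$ strongly antiadjacent. $2$-join: partition $(X_1,X_2)$ of $V(T)$ with disjoint $A_1,B_1,C_1,A_2,B_2,C_2$ (split), $X_i=A_i\cup B_i\cup C_i$, $A_i,B_i\ne\emptyset$, no switchable pair between $X_1$ and $X_2$, $A_1$ strongly adjacent to all of $A_2$, $B_1$ strongly adjacent to all of $B_2$, all other pairs between $X_1,X_2$ strongly antiadjacent, $|X_i|\ge3$, and if $|A_i|=|B_i|=1$ the full realization of $T|X_i$ is not a path of length two between the vertices of $A_i$ and $B_i$. It is odd if every path with one end in $A_i$, the other in $B_i$ and interior in $C_i$ ($i=1,2$) has odd length (in this setting all such paths have lengths of the same parity). A strongly stable set is a set of pairwise strongly antiadjacent vertices; for a trigraph $H$, $\alpha(H)$ is the maximum total weight of a strongly stable set of $H$ ($0$ for the empty trigraph). -}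

module Defs where

open import Level using (Level; _⊔_)
open import Data.Nat as ℕ using (ℕ; zero; suc; _+_; _∸_)
open import Data.Fin as Fin using (Fin; toℕ; fromℕ<)
open import Data.Fin.Subset using (Subset; _∈_; _∉_; _∪_; _⊆_; ⊤)
open import Data.Bool using (Bool; true; false; if_then_else_)
open import Data.Product using (Σ; ∃; _×_; _,_; ∃-syntax)
open import Data.Sum using (_⊎_)
open import Data.List using (List; []; _∷_)
open import Data.Vec using (lookup)
open import Data.Empty using (⊥)
open import Relation.Nullary using (¬_)
open import Relation.Binary.PropositionalEquality using (_≡_; _≢_)
open import Relation.Binary using (IsTotalOrder)
open import Function.Definitions using (Injective)
open import Algebra.Bundles using (AbelianGroup)

Odd : ℕ → Set
Odd k = ∃[ m ] k ≡ suc (m + m)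

data Val : Set where
  neg zer pos : Val   -- -1, 0, 1

negV : Val → Val
negV neg = pos
negV zer = zer
negV pos = neg

record Trigraph (n : ℕ) : Set where
  field
    θ   : Fin n → Fin n → Val
    sym : ∀ u v → θ u v ≡ θ v u
open Trigraph public

complement : ∀ {n} → Trigraph n → Trigraph n
complement T = record { θ = λ u v → negV (θ T u v) ; sym = λ u v → symNeg u v }
  where
  symNeg : ∀ u v → negV (θ T u v) ≡ negV (θ T v u)
  symNeg u v rewrite Trigraph.sym T u v = Relation.Binary.PropositionalEquality.refl

module _ {n : ℕ} (T : Trigraph n) where

  StronglyAdj StronglyAnti Switchable Adj Anti : Fin n → Fin n → Set
  StronglyAdj  u v = θ T u v ≡ pos
  StronglyAnti u v = θ T u v ≡ neg
  Switchable   u v = θ T u v ≡ zer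
  Adj  u v = θ T u v ≢ neg
  Anti u v = θ T u v ≢ pos

  data WalkIn (R : Fin n → Fin n → Set) (X : Subset n) : Fin n → Fin n → Set where
    here : ∀ {u} → u ∈ X → WalkIn R X u u
    step : ∀ {u v w} → u ∈ X → R u v → WalkIn R X v w → WalkIn R X u w

  -- X is connected: the full realization of T|X is connected
  Connected : Subset n → Set
  Connected X = ∀ u v → u ∈ X → v ∈ X → WalkIn Adj X u v

  -- X is anticonnected: the complement of the graph on X of strongly
  -- adjacent pairs is connected (its edges are the pairs with θ ≠ 1)
  Anticonnected : Subset n → Set
  Anticonnected X = ∀ u v → u ∈ X → v ∈ X → WalkIn Anti X u v

  -- Paths: p : Fin (suc k) → Fin n, vertices p 0, ..., p k (length k)
  IsPath : (k : ℕ) → (Fin (suc k) → Fin n) → Set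
  IsPath k p =
    Injective _≡_ _≡_ p
    × (∀ i j → suc (toℕ i) ≡ toℕ j → Adj (p i) (p j))
    × (∀ i j → suc (suc (toℕ i)) ℕ.≤ toℕ j → Anti (p i) (p j))

  InteriorIn : (k : ℕ) → (Fin (suc k) → Fin n) → Subset n → Set
  InteriorIn k p X = ∀ i → 0 ℕ.< toℕ i → toℕ i ℕ.< k → p i ∈ X

  firstV : ∀ {k} → (Fin (suc k) → Fin n) → Fin n
  firstV p = p Fin.zero

  lastV : ∀ {k} → (Fin (suc k) → Fin n) → Fin n
  lastV {k} p = p (Fin.fromℕ k)

  CyclicNbr : (k : ℕ) → Fin k → Fin k → Set
  CyclicNbr k i j =
    (suc (toℕ i) ≡ toℕ j) ⊎ (suc (toℕ j) ≡ toℕ i)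
    ⊎ ((toℕ i ≡ 0) × (suc (toℕ j) ≡ k)) ⊎ ((toℕ j ≡ 0) × (suc (toℕ i) ≡ k))

  IsHole : (k : ℕ) → (Fin k → Fin n) → Set
  IsHole k h =
    4 ℕ.≤ k
    × Injective _≡_ _≡_ h
    × (∀ i j → CyclicNbr k i j → Adj (h i) (h j))
    × (∀ i j → i ≢ j → ¬ CyclicNbr k i j → Anti (h i) (h j))

  HasOddHole : Set
  HasOddHole = ∃[ k ] Σ (Fin k → Fin n) λ h → Odd k × IsHole k h

Berge : ∀ {n} → Trigraph n → Set
Berge T = ¬ HasOddHole T × ¬ HasOddHole (complement T)

module _ {n : ℕ} (T : Trigraph n) where

  -- u and v are in the same component of Σ(T) (graph of switchable pairs)
  SameΣComp : Fin n → Fin n → Set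
  SameΣComp u v = WalkIn T (Switchable T) ⊤ u v

  record ΣEdge : Set where
    constructor edge
    field
      e₁ e₂ : Fin n
      distinct : e₁ ≢ e₂
      sw : Switchable T e₁ e₂

  SameEdge : ΣEdge → ΣEdge → Set
  SameEdge (edge a b _ _) (edge c d _ _) = (a ≡ c × b ≡ d) ⊎ (a ≡ d × b ≡ c)

  -- every component of Σ(T) has at most two edges
  ComponentsAtMostTwoEdges : Set
  ComponentsAtMostTwoEdges =
    (e f g : ΣEdge) → ¬ SameEdge e f → ¬ SameEdge e g → ¬ SameEdge f g →
    ¬ (SameΣComp (ΣEdge.e₁ e) (ΣEdge.e₁ f) × SameΣComp (ΣEdge.e₁ e) (ΣEdge.e₁ g))

  ΣDegTwo : Fin n → Fin n → Fin n → Set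
  ΣDegTwo v x y =
    x ≢ y × x ≢ v × y ≢ v × Switchable T v x × Switchable T v y
    × (∀ z → z ≢ v → Switchable T v z → z ≡ x ⊎ z ≡ y)

  DegTwoCondition : Set
  DegTwoCondition = ∀ v x y → ΣDegTwo v x y →
      ((∀ z → z ≢ v → z ≢ x → z ≢ y → StronglyAdj T v z) × StronglyAdj T x y)
    ⊎ ((∀ z → z ≢ v → z ≢ x → z ≢ y → StronglyAnti T v z) × StronglyAnti T x y)

InF : ∀ {n} → Trigraph n → Set
InF T = Berge T × ComponentsAtMostTwoEdges T × DegTwoCondition T

module _ {n : ℕ} (T : Trigraph n) where

  IsPartition : Subset n → Subset n → Set
  IsPartition A B = (∀ v → v ∈ A ⊎ v ∈ B) × (∀ v → v ∈ A → v ∈ B → ⊥)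

  IsSkewPartition : Subset n → Subset n → Set
  IsSkewPartition A B = IsPartition A B × ¬ Connected T A × ¬ Anticonnected T B

  IsBalancedSkewPartition : Subset n → Subset n → Set
  IsBalancedSkewPartition A B =
    IsSkewPartition A B
    × (∀ k p → IsPath T k p → Odd k → 1 ℕ.< k →
         firstV T p ∈ B → lastV T p ∈ B → ¬ InteriorIn T k p A)
    × (∀ k p → IsPath (complement T) k p → Odd k → 1 ℕ.< k →
         firstV T p ∈ A → lastV T p ∈ A → ¬ InteriorIn T k p B)

HasBalancedSkewPartition : ∀ {n} → Trigraph n → Set
HasBalancedSkewPartition {n} T = ∃[ A ] ∃[ B ] IsBalancedSkewPartition T A B

module _ {n : ℕ} (T : Trigraph n) where

  Disjoint : Subset n → Subset n → Set
  Disjoint X Y = ∀ v → v ∈ X → v ∈ Y → ⊥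

  NonEmpty : Subset n → Set
  NonEmpty X = ∃[ v ] v ∈ X

  AtLeastThree : Subset n → Set
  AtLeastThree X = ∃[ a ] ∃[ b ] ∃[ c ] a ∈ X × b ∈ X × c ∈ X × a ≢ b × a ≢ c × b ≢ c

  AtMostOne : Subset n → Set
  AtMostOne X = ∀ u v → u ∈ X → v ∈ X → u ≡ v

  IsLengthTwoPathBetween : Subset n → Subset n → Subset n → Set
  IsLengthTwoPathBetween X A B =
    ∃[ a ] ∃[ b ] ∃[ c ] a ∈ A × b ∈ B × c ∈ X
      × (∀ x → x ∈ X → x ≡ a ⊎ x ≡ b ⊎ x ≡ c)
      × a ≢ c × b ≢ c × a ≢ b
      × Adj T a c × Adj T c b × StronglyAnti T a b

  SideCondition : Subset n → Subset n → Subset n → Set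
  SideCondition A B C =
    NonEmpty A × NonEmpty B × AtLeastThree (A ∪ B ∪ C)
    × (AtMostOne A → AtMostOne B → ¬ IsLengthTwoPathBetween (A ∪ B ∪ C) A B)

  IsSplitOf2Join : (X₁ X₂ A₁ B₁ C₁ A₂ B₂ C₂ : Subset n) → Set
  IsSplitOf2Join X₁ X₂ A₁ B₁ C₁ A₂ B₂ C₂ =
    IsPartition T X₁ X₂
    × (∀ v → v ∈ X₁ → v ∈ A₁ ⊎ v ∈ B₁ ⊎ v ∈ C₁)
    × (∀ v → v ∈ X₂ → v ∈ A₂ ⊎ v ∈ B₂ ⊎ v ∈ C₂)
    × (A₁ ⊆ X₁) × (B₁ ⊆ X₁) × (C₁ ⊆ X₁)
    × (A₂ ⊆ X₂) × (B₂ ⊆ X₂) × (C₂ ⊆ X₂)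
    × Disjoint A₁ B₁ × Disjoint A₁ C₁ × Disjoint B₁ C₁
    × Disjoint A₂ B₂ × Disjoint A₂ C₂ × Disjoint B₂ C₂
    × (∀ u v → u ∈ X₁ → v ∈ X₂ →
         (u ∈ A₁ → v ∈ A₂ → StronglyAdj T u v)
       × (u ∈ B₁ → v ∈ B₂ → StronglyAdj T u v)
       × (¬ (u ∈ A₁ × v ∈ A₂) → ¬ (u ∈ B₁ × v ∈ B₂) → StronglyAnti T u v))
    × SideCondition A₁ B₁ C₁
    × SideCondition A₂ B₂ C₂

  OddPathsBetween : Subset n → Subset n → Subset n → Set
  OddPathsBetween A B C =
    ∀ k p → IsPath T k p →
      ((firstV T p ∈ A × lastV T p ∈ B) ⊎ (firstV T p ∈ B × lastV T p ∈ A)) →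
      InteriorIn T k p C → Odd k

  IsSplitOfOdd2Join : (X₁ X₂ A₁ B₁ C₁ A₂ B₂ C₂ : Subset n) → Set
  IsSplitOfOdd2Join X₁ X₂ A₁ B₁ C₁ A₂ B₂ C₂ =
    IsSplitOf2Join X₁ X₂ A₁ B₁ C₁ A₂ B₂ C₂
    × OddPathsBetween A₁ B₁ C₁ × OddPathsBetween A₂ B₂ C₂

-- Weights in an ordered abelian group (ℝ being the intended instance)

record OrderedAbelianGroup c ℓ₁ ℓ₂ : Set (Level.suc (c ⊔ ℓ₁ ⊔ ℓ₂)) where
  field
    abelianGroup : AbelianGroup c ℓ₁
  open AbelianGroup abelianGroup public
  field
    _≤_         : Carrier → Carrier → Set ℓ₂
    isTotalOrder : IsTotalOrder _≈_ _≤_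
    ∙-monoˡ-≤    : ∀ {x y} z → x ≤ y → (x ∙ z) ≤ (y ∙ z)

module _ {c ℓ₁ ℓ₂} (G : OrderedAbelianGroup c ℓ₁ ℓ₂) where
  open OrderedAbelianGroup G

  sumFin : ∀ {n} → (Fin n → Carrier) → Carrier
  sumFin {zero}  f = ε
  sumFin {suc n} f = f Fin.zero ∙ sumFin (λ i → f (Fin.suc i))

  weight : ∀ {n} → (Fin n → Carrier) → Subset n → Carrier
  weight w S = sumFin (λ v → if lookup S v then w v else ε)

  module _ {n : ℕ} (T : Trigraph n) where

    StronglyStable : Subset n → Set
    StronglyStable S = ∀ u v → u ∈ S → v ∈ S → u ≢ v → StronglyAnti T u v

    -- a is α(T|X) for weights w: the maximum weight of a strongly stable
    -- set of T|X (i.e. a strongly stable set of T contained in X)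
    IsAlpha : (Fin n → Carrier) → Subset n → Carrier → Set (ℓ₁ ⊔ ℓ₂)
    IsAlpha w X a =
      (∃[ S ] (S ⊆ X × StronglyStable S × weight w S ≈ a))
      × (∀ S → S ⊆ X → StronglyStable S → weight w S ≤ a)

-- Let S be a maximum-weight strongly stable set in X₁ and S′ one in C₁, and join two vertices of
-- S ∪ S′ when they are adjacent. Both sets being strongly stable, every walk alternates between S
-- and S′ ∖ S, so a walk from S ∩ B₁ to S ∩ A₁ has even length; but a shortest such walk is a path
-- from B₁ to A₁ with interior in C₁, of odd length since the 2-join is odd. Hence the set R of
-- vertices joined to S ∩ A₁ avoids S ∩ B₁, and exchanging S and S′ on R yields strongly stable
-- sets (S ∩ R) ∪ (S′ ∖ R) ⊆ A₁ ∪ C₁ and (S′ ∩ R) ∪ (S ∖ R) ⊆ B₁ ∪ C₁ of the same total weight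
-- as S and S′.
module Submission where

open import Defs hiding (sym)
open import Level using (0ℓ)
open import Data.Nat using (ℕ; zero; suc)
open import Data.Fin using (Fin; zero; suc; toℕ; _≟_)
open import Data.Fin.Properties
  using (pigeonhole; toℕ≤pred[n]; toℕ-injective; toℕ-fromℕ; any?)
open import Data.Fin.Subset using (Subset; _∈_; _∉_; _⊆_; _∪_; _∩_)
open import Data.Fin.Subset.Properties using (_∈?_; x∈p∪q⁺; x∈p∪q⁻; x∈p∩q⁺; x∈p∩q⁻)
open import Data.Bool using (Bool; true; false; if_then_else_)
open import Data.Vec using (lookup; tabulate)
open import Data.Vec.Properties using (lookup∘tabulate; []=⇒lookup; lookup⇒[]=)
open import Data.Product using (Σ; ∃; ∃₂; _×_; _,_; proj₁; proj₂)
open import Data.Sum using (_⊎_; inj₁; inj₂)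
open import Data.Empty using (⊥; ⊥-elim)
open import Function using (_∘_)
open import Function.Definitions using (Injective)
open import Relation.Nullary using (¬_; Dec; yes; no; does; ¬?)
open import Relation.Nullary.Decidable using (map′; _×-dec_)
open import Relation.Unary using (Pred; Decidable)
open import Relation.Binary using (IsTotalOrder; tri<; tri≈; tri>)
open import Relation.Binary.PropositionalEquality
import Algebra.Properties.CommutativeSemigroup as CommutativeSemigroupProperties
import Relation.Binary.Reasoning.Base.Double as PreorderReasoning

module Walks {n : ℕ} (_~_ : Fin n → Fin n → Set) where
  open import Data.Nat using (_+_; _∸_; _≤_; _<_; z≤n; s≤s; z<s; _<?_)
  open import Data.Nat.Properties
  open import Data.Nat.Induction using (<-rec)

  Walk : ℕ → (ℕ → Fin n) → Set
  Walk k f = ∀ m → m < k → f m ~ f (suc m)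

  _⇝[_]_ : Fin n → ℕ → Fin n → Set
  x ⇝[ k ] y = Σ (ℕ → Fin n) λ f → Walk k f × f 0 ≡ x × f k ≡ y

  _⇝[<_]_ : Fin n → ℕ → Fin n → Set
  x ⇝[< k ] y = ∃ λ k′ → k′ < k × x ⇝[ k′ ] y

  ⇝-refl : ∀ {x} → x ⇝[ 0 ] x
  ⇝-refl {x} = (λ _ → x) , (λ _ ()) , refl , refl

  ⇝-prefix : ∀ {k f} i → Walk k f → i ≤ k → f 0 ⇝[ i ] f i
  ⇝-prefix i w i≤k = _ , (λ m m<i → w m (<-≤-trans m<i i≤k)) , refl , refl

  ⇝-suffix : ∀ {k f} i → Walk k f → i ≤ k → f i ⇝[ k ∸ i ] f k
  ⇝-suffix {k} {f} i w i≤k = (λ x → f (x + i)) , shifted , refl , cong f (m∸n+n≡m i≤k)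
    where
    shifted : Walk (k ∸ i) (λ x → f (x + i))
    shifted m m<k∸i = w (m + i) (subst (m + i <_) (m∸n+n≡m i≤k) (+-monoˡ-< i m<k∸i))

  ⇝-join : ∀ {i j x y y′ z} → x ⇝[ i ] y → y ~ y′ → y′ ⇝[ j ] z → x ⇝[ suc i + j ] z
  ⇝-join {i} {j} (f , wf , refl , refl) e (g , wg , refl , refl) =
    h , wh , h-≤ z≤n , trans (h-> (s≤s (m≤m+n i j))) (cong g (m+n∸m≡n i j))
    where
    h : ℕ → Fin n
    h x with x ≤? i
    ... | yes _ = f x
    ... | no _ = g (x ∸ suc i)

    h-≤ : ∀ {x} → x ≤ i → h x ≡ f x
    h-≤ {x} x≤i with x ≤? i
    ... | yes _ = refl
    ... | no x≰i = ⊥-elim (x≰i x≤i)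

    h-> : ∀ {x} → i < x → h x ≡ g (x ∸ suc i)
    h-> {x} i<x with x ≤? i
    ... | yes x≤i = ⊥-elim (<⇒≱ i<x x≤i)
    ... | no _ = refl

    wh : Walk (suc i + j) h
    wh m m<i+1+j with <-cmp m i
    ... | tri< m<i _ _ = subst₂ _~_ (sym (h-≤ (<⇒≤ m<i))) (sym (h-≤ m<i)) (wf m m<i)
    ... | tri≈ _ refl _ =
      subst₂ _~_ (sym (h-≤ ≤-refl)) (sym (trans (h-> ≤-refl) (cong g (n∸n≡0 i)))) e
    ... | tri> _ _ i<m =
      subst₂ _~_ (sym (h-> i<m)) (sym (trans (h-> (m<n⇒m<1+n i<m)) (cong g (+-∸-assoc 1 i<m))))
        (wg (m ∸ suc i) (subst (m ∸ suc i <_) (m+n∸m≡n i j) (∸-monoˡ-< m<i+1+j i<m)))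

  ⇝-skip : ∀ {k f i j} → Walk k f → suc i < j → j ≤ k → f i ~ f j → f 0 ⇝[< k ] f k
  ⇝-skip {k} {f} {i} {j} w i+1<j j≤k e =
    suc i + (k ∸ j) , shorter , ⇝-join (⇝-prefix i w i≤k) e (⇝-suffix j w j≤k)
    where
    i≤k : i ≤ k
    i≤k = ≤-trans (n≤1+n i) (≤-trans (<⇒≤ i+1<j) j≤k)
    shorter : suc i + (k ∸ j) < k
    shorter = <-≤-trans (+-monoˡ-< (k ∸ j) i+1<j) (≤-reflexive (m+[n∸m]≡n j≤k))

  ⇝-repeat : ∀ {k f i j} → Walk k f → i < j → j ≤ k → f i ≡ f j → f 0 ⇝[< k ] f k
  ⇝-repeat {k} {f} {i} {j} w i<j j≤k fi≡fj with m≤n⇒m<n∨m≡n j≤k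
  ... | inj₁ j<k = ⇝-skip w (s≤s i<j) j<k (subst (_~ f (suc j)) (sym fi≡fj) (w j j<k))
  ... | inj₂ refl = i , i<j , subst (f 0 ⇝[ i ]_) fi≡fj (⇝-prefix i w (<⇒≤ i<j))

  -- A walk with at least n steps repeats a vertex (pigeonhole) and can be cut short there.
  ⇝-shorten : ∀ k {x y} → x ⇝[ k ] y → x ⇝[< n ] y
  ⇝-shorten = <-rec (λ k → ∀ {x y} → x ⇝[ k ] y → x ⇝[< n ] y) shorten
    where
    shorten : ∀ k → (∀ {k′} → k′ < k → ∀ {x y} → x ⇝[ k′ ] y → x ⇝[< n ] y) →
              ∀ {x y} → x ⇝[ k ] y → x ⇝[< n ] y
    shorten k rec walk@(f , w , refl , refl) with k <? n
    ... | yes k<n = k , k<n , walk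
    ... | no k≮n with a , b , a<b , fa≡fb ← pigeonhole (n<1+n n) (f ∘ toℕ)
                 with k′ , k′<k , walk′ ← ⇝-repeat w a<b (≤-trans (toℕ≤pred[n] b) (≮⇒≥ k≮n)) fa≡fb
      = rec k′<k walk′

  module Reachability (Tgt : Pred (Fin n) 0ℓ) (Tgt? : Decidable Tgt)
                      (_~?_ : ∀ x y → Dec (x ~ y)) where

    ReachesIn : ℕ → Fin n → Set
    ReachesIn k x = ∃ λ y → Tgt y × x ⇝[ k ] y

    reachesIn? : ∀ k x → Dec (ReachesIn k x)
    reachesIn? zero x =
      map′ (λ t → x , t , ⇝-refl) (λ { (_ , t , _ , _ , refl , refl) → t }) (Tgt? x)
    reachesIn? (suc k) x = map′ prepend first-step (any? λ u → x ~? u ×-dec reachesIn? k u)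
      where
      prepend : ∃ (λ u → x ~ u × ReachesIn k u) → ReachesIn (suc k) x
      prepend (_ , e , y , t , walk) = y , t , ⇝-join ⇝-refl e walk
      first-step : ReachesIn (suc k) x → ∃ λ u → x ~ u × ReachesIn k u
      first-step (_ , t , f , w , refl , refl) = f 1 , w 0 z<s , _ , t , ⇝-suffix 1 w (s≤s z≤n)

    -- Bounding the length makes reachability decidable; by ⇝-shorten nothing is lost.
    Reaches : Pred (Fin n) 0ℓ
    Reaches x = ∃ λ k → k < n × ReachesIn k x

    reaches? : Decidable Reaches
    reaches? x = anyUpTo? (λ k → reachesIn? k x) n

    reaches-start : ∀ {x} → Tgt x → Reaches x
    reaches-start t with k , k<n , walk ← ⇝-shorten 0 ⇝-refl = k , k<n , _ , t , walk

    reaches-step : ∀ {x y} → x ~ y → Reaches y → Reaches x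
    reaches-step e (_ , _ , _ , t , walk)
      with k , k<n , walk′ ← ⇝-shorten _ (⇝-join ⇝-refl e walk) = k , k<n , _ , t , walk′

  module _ (Src Tgt : Fin n → Set) where

    record ShortestWalk (k : ℕ) (f : ℕ → Fin n) : Set where
      field
        walk    : Walk k f
        start   : Src (f 0)
        end     : Tgt (f k)
        shortest : ∀ {k′} → k′ < k → ∀ {x y} → Src x → Tgt y → ¬ x ⇝[ k′ ] y

      no-shortcut : ¬ f 0 ⇝[< k ] f k
      no-shortcut (_ , k′<k , walk′) = shortest k′<k start end walk′

      injective : ∀ {i j} → i < j → j ≤ k → f i ≢ f j
      injective i<j j≤k = no-shortcut ∘ ⇝-repeat walk i<j j≤k

      chordless : ∀ {i j} → suc i < j → j ≤ k → ¬ f i ~ f j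
      chordless i+1<j j≤k = no-shortcut ∘ ⇝-skip walk i+1<j j≤k

      interior-∉-src : ∀ {i} → 0 < i → i < k → ¬ Src (f i)
      interior-∉-src 0<i i<k s =
        shortest (∸-monoʳ-< 0<i (<⇒≤ i<k)) s end (⇝-suffix _ walk (<⇒≤ i<k))

      interior-∉-tgt : ∀ {i} → i < k → ¬ Tgt (f i)
      interior-∉-tgt i<k t = shortest i<k start t (⇝-prefix _ walk (<⇒≤ i<k))

    no-walk : (∀ {k f} → ShortestWalk k f → ⊥) → ∀ k {x y} → Src x → Tgt y → ¬ x ⇝[ k ] y
    no-walk no-shortest = <-rec (λ k → ∀ {x y} → Src x → Tgt y → ¬ x ⇝[ k ] y)
      λ { _ shorter s t (_ , w , refl , refl) →
            no-shortest record { walk = w ; start = s ; end = t ; shortest = shorter } }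

glue : ∀ {n p} {P : Pred (Fin n) p} → Decidable P → Subset n → Subset n → Subset n
glue P? S S′ = tabulate λ v → if does (P? v) then lookup S v else lookup S′ v

∈-glue⁻ : ∀ {n p} {P : Pred (Fin n) p} (P? : Decidable P) (S S′ : Subset n) {v} →
          v ∈ glue P? S S′ → (P v × v ∈ S) ⊎ (¬ P v × v ∈ S′)
∈-glue⁻ P? S S′ {v} v∈ with P? v | trans (sym (lookup∘tabulate _ v)) ([]=⇒lookup v∈)
... | yes p | eq = inj₁ (p , lookup⇒[]= v S eq)
... | no ¬p | eq = inj₂ (¬p , lookup⇒[]= v S′ eq)

strongly-anti? : ∀ {n} (T : Trigraph n) u v → Dec (StronglyAnti T u v)
strongly-anti? T u v with θ T u v
... | neg = yes refl
... | zer = no λ ()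
... | pos = no λ ()

strongly-adj⇒adj : ∀ {n} (T : Trigraph n) {u v} → StronglyAdj T u v → Adj T u v
strongly-adj⇒adj T p q with () ← trans (sym p) q

module OddSideExchange {n : ℕ} (T : Trigraph n) {S S′ A B C : Subset n}
  (S-stable : ∀ u v → u ∈ S → v ∈ S → u ≢ v → StronglyAnti T u v)
  (S′-stable : ∀ u v → u ∈ S′ → v ∈ S′ → u ≢ v → StronglyAnti T u v)
  (S⊆A∪B∪C : ∀ v → v ∈ S → v ∈ A ⊎ v ∈ B ⊎ v ∈ C)
  (S′⊆C : S′ ⊆ C)
  (odd : OddPathsBetween T A B C)
  where
  open import Data.Nat using (_+_; _≤_; _<_; z<s)
  open import Data.Nat.Properties
    using (+-suc; ≤-refl; ≤-trans; n≤1+n; <⇒≤; <-cmp; <-trans; n<1+n; <-≤-trans)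

  _~_ : Fin n → Fin n → Set
  u ~ v = u ≢ v × Adj T u v × u ∈ S ∪ S′ × v ∈ S ∪ S′

  _~?_ : ∀ u v → Dec (u ~ v)
  u ~? v =
    ¬? (u ≟ v) ×-dec ¬? (strongly-anti? T u v) ×-dec (u ∈? S ∪ S′) ×-dec (v ∈? S ∪ S′)

  ~-sym : ∀ {u v} → u ~ v → v ~ u
  ~-sym {u} {v} (u≢v , adj , u∈ , v∈) = u≢v ∘ sym , adj ∘ trans (Trigraph.sym T u v) , v∈ , u∈

  open Walks _~_

  ~-leaves-S : ∀ {u v} → u ~ v → u ∈ S → v ∉ S
  ~-leaves-S (u≢v , adj , _) u∈S v∈S = adj (S-stable _ _ u∈S v∈S u≢v)

  ~-enters-S : ∀ {u v} → u ~ v → u ∉ S → v ∈ S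
  ~-enters-S (u≢v , adj , u∈ , v∈) u∉S with x∈p∪q⁻ S S′ u∈ | x∈p∪q⁻ S S′ v∈
  ... | inj₁ u∈S  | _          = ⊥-elim (u∉S u∈S)
  ... | inj₂ _    | inj₁ v∈S   = v∈S
  ... | inj₂ u∈S′ | inj₂ v∈S′  = ⊥-elim (adj (S′-stable _ _ u∈S′ v∈S′ u≢v))

  even-steps-in-S : ∀ {k f} → Walk k f → f 0 ∈ S → ∀ m → m + m ≤ k → f (m + m) ∈ S
  even-steps-in-S w f0∈S zero _ = f0∈S
  even-steps-in-S {k} {f} w f0∈S (suc m) 2m+2≤k =
    subst (λ i → f (suc i) ∈ S) (sym (+-suc m m))
      (~-enters-S (w (suc (m + m)) 2m+2≤k′)
        (~-leaves-S (w (m + m) 2m<k) (even-steps-in-S w f0∈S m (<⇒≤ 2m<k))))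
    where
    2m+2≤k′ : suc (suc (m + m)) ≤ k
    2m+2≤k′ = subst (_≤ k) (cong suc (+-suc m m)) 2m+2≤k
    2m<k : m + m < k
    2m<k = ≤-trans (n≤1+n _) 2m+2≤k′

  odd-walk-leaves-S : ∀ {k f} → Walk k f → Odd k → f 0 ∈ S → f k ∉ S
  odd-walk-leaves-S w (m , refl) f0∈S =
    ~-leaves-S (w (m + m) ≤-refl) (even-steps-in-S w f0∈S m (n≤1+n _))

  walk-∈ : ∀ {k f i} → Walk k f → 0 < k → i ≤ k → f i ∈ S ∪ S′
  walk-∈ {i = zero}  w 0<k _   = proj₁ (proj₂ (proj₂ (w 0 0<k)))
  walk-∈ {i = suc i} w _   i<k = proj₂ (proj₂ (proj₂ (w i i<k)))

  non-neighbours-anti : ∀ {u v} → u ≢ v → u ∈ S ∪ S′ → v ∈ S ∪ S′ → ¬ u ~ v → Anti T u v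
  non-neighbours-anti u≢v u∈ v∈ ¬u~v θ≡pos =
    ¬u~v (u≢v , strongly-adj⇒adj T θ≡pos , u∈ , v∈)

  ShortestWalkFromBToA : ℕ → (ℕ → Fin n) → Set
  ShortestWalkFromBToA = ShortestWalk (_∈ S ∩ B) (_∈ S ∩ A)

  shortest-walk-is-path : ∀ {k f} → ShortestWalkFromBToA k f → IsPath T k (f ∘ toℕ)
  shortest-walk-is-path {k} {f} sw = inj , adj , anti
    where
    open ShortestWalk sw

    inj : Injective _≡_ _≡_ (f ∘ toℕ)
    inj {i} {j} fi≡fj with <-cmp (toℕ i) (toℕ j)
    ... | tri< i<j _ _ = ⊥-elim (injective i<j (toℕ≤pred[n] j) fi≡fj)
    ... | tri≈ _ i≡j _ = toℕ-injective i≡j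
    ... | tri> _ _ j<i = ⊥-elim (injective j<i (toℕ≤pred[n] i) (sym fi≡fj))

    adj : ∀ i j → suc (toℕ i) ≡ toℕ j → Adj T (f (toℕ i)) (f (toℕ j))
    adj i j i+1≡j = subst (λ x → Adj T (f (toℕ i)) (f x)) i+1≡j
      (proj₁ (proj₂ (walk (toℕ i) (subst (_≤ k) (sym i+1≡j) (toℕ≤pred[n] j)))))

    anti : ∀ i j → suc (suc (toℕ i)) ≤ toℕ j → Anti T (f (toℕ i)) (f (toℕ j))
    anti i j i+1<j = non-neighbours-anti (injective i<j j≤k)
      (walk-∈ walk 0<k (<⇒≤ (<-≤-trans i<j j≤k))) (walk-∈ walk 0<k j≤k) (chordless i+1<j j≤k)
      where
      i<j : toℕ i < toℕ j
      i<j = <-trans (n<1+n _) i+1<j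
      j≤k : toℕ j ≤ k
      j≤k = toℕ≤pred[n] j
      0<k : 0 < k
      0<k = <-≤-trans (<-≤-trans z<s i+1<j) j≤k

  shortest-walk-interior-in-C : ∀ {k f} → ShortestWalkFromBToA k f → InteriorIn T k (f ∘ toℕ) C
  shortest-walk-interior-in-C sw i 0<i i<k
    with x∈p∪q⁻ S S′ (walk-∈ (ShortestWalk.walk sw) (<-trans 0<i i<k) (<⇒≤ i<k))
  ... | inj₂ ∈S′ = S′⊆C ∈S′
  ... | inj₁ ∈S with S⊆A∪B∪C _ ∈S
  ...   | inj₁ ∈A        = ⊥-elim (ShortestWalk.interior-∉-tgt sw i<k (x∈p∩q⁺ (∈S , ∈A)))
  ...   | inj₂ (inj₁ ∈B) = ⊥-elim (ShortestWalk.interior-∉-src sw 0<i i<k (x∈p∩q⁺ (∈S , ∈B)))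
  ...   | inj₂ (inj₂ ∈C) = ∈C

  no-shortest-walk : ∀ {k f} → ShortestWalkFromBToA k f → ⊥
  no-shortest-walk {k} {f} sw = odd-walk-leaves-S walk k-odd (proj₁ start-∈) (proj₁ end-∈)
    where
    open ShortestWalk sw
    start-∈ : f 0 ∈ S × f 0 ∈ B
    start-∈ = x∈p∩q⁻ S B start
    end-∈ : f k ∈ S × f k ∈ A
    end-∈ = x∈p∩q⁻ S A end
    k-odd : Odd k
    k-odd = odd k (f ∘ toℕ) (shortest-walk-is-path sw)
      (inj₂ (proj₂ start-∈ , subst (λ i → f i ∈ A) (sym (toℕ-fromℕ k)) (proj₂ end-∈)))
      (shortest-walk-interior-in-C sw)

  open Reachability (_∈ S ∩ A) (_∈? S ∩ A) _~?_ public

  reaches-∉-S∩B : ∀ {v} → Reaches v → v ∉ S ∩ B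
  reaches-∉-S∩B (k , _ , _ , t , walk) v∈S∩B =
    no-walk (_∈ S ∩ B) (_∈ S ∩ A) no-shortest-walk k v∈S∩B t walk

  reaches-boundary-anti : ∀ {u v} → Reaches u → ¬ Reaches v →
    u ∈ S ∪ S′ → v ∈ S ∪ S′ → u ≢ v → StronglyAnti T u v
  reaches-boundary-anti {u} {v} ru ¬rv u∈ v∈ u≢v with strongly-anti? T u v
  ... | yes anti = anti
  ... | no adj = ⊥-elim (¬rv (reaches-step (~-sym (u≢v , adj , u∈ , v∈)) ru))

  glue-stable : ∀ {P Q} →
    (∀ u v → u ∈ P → v ∈ P → u ≢ v → StronglyAnti T u v) →
    (∀ u v → u ∈ Q → v ∈ Q → u ≢ v → StronglyAnti T u v) →
    P ⊆ S ∪ S′ → Q ⊆ S ∪ S′ →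
    ∀ u v → u ∈ glue reaches? P Q → v ∈ glue reaches? P Q → u ≢ v → StronglyAnti T u v
  glue-stable {P} {Q} P-stable Q-stable P⊆ Q⊆ u v u∈ v∈ u≢v
    with ∈-glue⁻ reaches? P Q u∈ | ∈-glue⁻ reaches? P Q v∈
  ... | inj₁ (_ , u∈P)   | inj₁ (_ , v∈P)   = P-stable u v u∈P v∈P u≢v
  ... | inj₂ (_ , u∈Q)   | inj₂ (_ , v∈Q)   = Q-stable u v u∈Q v∈Q u≢v
  ... | inj₁ (ru , u∈P)  | inj₂ (¬rv , v∈Q) =
    reaches-boundary-anti ru ¬rv (P⊆ u∈P) (Q⊆ v∈Q) u≢v
  ... | inj₂ (¬ru , u∈Q) | inj₁ (rv , v∈P)  =
    trans (Trigraph.sym T u v) (reaches-boundary-anti rv ¬ru (P⊆ v∈P) (Q⊆ u∈Q) (u≢v ∘ sym))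

  S₁ S₂ : Subset n
  S₁ = glue reaches? S S′
  S₂ = glue reaches? S′ S

  S₁-stable : ∀ u v → u ∈ S₁ → v ∈ S₁ → u ≢ v → StronglyAnti T u v
  S₁-stable = glue-stable S-stable S′-stable (x∈p∪q⁺ ∘ inj₁) (x∈p∪q⁺ ∘ inj₂)

  S₂-stable : ∀ u v → u ∈ S₂ → v ∈ S₂ → u ≢ v → StronglyAnti T u v
  S₂-stable = glue-stable S′-stable S-stable (x∈p∪q⁺ ∘ inj₂) (x∈p∪q⁺ ∘ inj₁)

  S₁⊆A∪C : S₁ ⊆ A ∪ C
  S₁⊆A∪C v∈ with ∈-glue⁻ reaches? S S′ v∈
  ... | inj₂ (_ , v∈S′) = x∈p∪q⁺ (inj₂ (S′⊆C v∈S′))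
  ... | inj₁ (rv , v∈S) with S⊆A∪B∪C _ v∈S
  ...   | inj₁ v∈A        = x∈p∪q⁺ (inj₁ v∈A)
  ...   | inj₂ (inj₁ v∈B) = ⊥-elim (reaches-∉-S∩B rv (x∈p∩q⁺ (v∈S , v∈B)))
  ...   | inj₂ (inj₂ v∈C) = x∈p∪q⁺ (inj₂ v∈C)

  S₂⊆B∪C : S₂ ⊆ B ∪ C
  S₂⊆B∪C v∈ with ∈-glue⁻ reaches? S′ S v∈
  ... | inj₁ (_ , v∈S′) = x∈p∪q⁺ (inj₂ (S′⊆C v∈S′))
  ... | inj₂ (¬rv , v∈S) with S⊆A∪B∪C _ v∈S
  ...   | inj₁ v∈A        = ⊥-elim (¬rv (reaches-start (x∈p∩q⁺ (v∈S , v∈A))))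
  ...   | inj₂ (inj₁ v∈B) = x∈p∪q⁺ (inj₁ v∈B)
  ...   | inj₂ (inj₂ v∈C) = x∈p∪q⁺ (inj₂ v∈C)

module Weights {c ℓ₁ ℓ₂} (G : OrderedAbelianGroup c ℓ₁ ℓ₂) where
  open OrderedAbelianGroup G renaming (refl to ≈-refl; trans to ≈-trans; sym to ≈-sym)
  open CommutativeSemigroupProperties commutativeSemigroup using (interchange)
  open IsTotalOrder isTotalOrder using ()
    renaming (trans to ≤-trans′; reflexive to ≤-reflexive′)

  ∙-mono-≤ : ∀ {x y u v} → x ≤ y → u ≤ v → (x ∙ u) ≤ (y ∙ v)
  ∙-mono-≤ {x} {y} {u} {v} x≤y u≤v =
    ≤-trans′ (∙-monoˡ-≤ u x≤y)
      (≤-trans′ (≤-reflexive′ (comm y u)) (≤-trans′ (∙-monoˡ-≤ y u≤v) (≤-reflexive′ (comm v y))))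

  sumFin-cong : ∀ {m} {f g : Fin m → Carrier} → (∀ v → f v ≈ g v) → sumFin G f ≈ sumFin G g
  sumFin-cong {zero}  f≈g = ≈-refl
  sumFin-cong {suc m} f≈g = ∙-cong (f≈g zero) (sumFin-cong (λ v → f≈g (suc v)))

  sumFin-∙ : ∀ {m} (f g : Fin m → Carrier) →
    (sumFin G f ∙ sumFin G g) ≈ sumFin G (λ v → f v ∙ g v)
  sumFin-∙ {zero}  f g = identityˡ ε
  sumFin-∙ {suc m} f g =
    ≈-trans (interchange _ _ _ _) (∙-cong ≈-refl (sumFin-∙ (λ v → f (suc v)) (λ v → g (suc v))))

  weight-glue : ∀ {n p} {P : Pred (Fin n) p} (P? : Decidable P)
    (w : Fin n → Carrier) (S S′ : Subset n) →
    (weight G w (glue P? S S′) ∙ weight G w (glue P? S′ S)) ≈ (weight G w S ∙ weight G w S′)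
  weight-glue P? w S S′ =
    ≈-trans (sumFin-∙ (part (glue P? S S′)) (part (glue P? S′ S)))
      (≈-trans (sumFin-cong pointwise) (≈-sym (sumFin-∙ (part S) (part S′))))
    where
    select : Bool → Carrier → Carrier
    select b x = if b then x else ε
    part : Subset _ → Fin _ → Carrier
    part X v = select (lookup X v) (w v)
    swap-if : ∀ b s s′ x →
      (select (if b then s else s′) x ∙ select (if b then s′ else s) x) ≈ (select s x ∙ select s′ x)
    swap-if true  _ _ _ = ≈-refl
    swap-if false _ _ _ = comm _ _
    pointwise : ∀ v → (part (glue P? S S′) v ∙ part (glue P? S′ S) v) ≈ (part S v ∙ part S′ v)
    pointwise v rewrite lookup∘tabulate (λ u → if does (P? u) then lookup S u else lookup S′ u) v
                      | lookup∘tabulate (λ u → if does (P? u) then lookup S′ u else lookup S u) v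
      = swap-if (does (P? v)) (lookup S v) (lookup S′ v) (w v)

odd-side-exchange : ∀ {c ℓ₁ ℓ₂} (G : OrderedAbelianGroup c ℓ₁ ℓ₂) →
  let open OrderedAbelianGroup G in
  ∀ {n} (T : Trigraph n) (w : Fin n → Carrier) {S S′ A B C : Subset n} →
  StronglyStable G T S → StronglyStable G T S′ →
  (∀ v → v ∈ S → v ∈ A ⊎ v ∈ B ⊎ v ∈ C) → S′ ⊆ C → OddPathsBetween T A B C →
  ∃₂ λ S₁ S₂ → (S₁ ⊆ A ∪ C × StronglyStable G T S₁) × (S₂ ⊆ B ∪ C × StronglyStable G T S₂)
             × (weight G w S₁ ∙ weight G w S₂) ≈ (weight G w S ∙ weight G w S′)
odd-side-exchange G T w {S} {S′} S-stable S′-stable S⊆A∪B∪C S′⊆C odd =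
  S₁ , S₂ , (S₁⊆A∪C , S₁-stable) , (S₂⊆B∪C , S₂-stable) , weight-glue reaches? w S S′
  where
  open OddSideExchange T S-stable S′-stable S⊆A∪B∪C S′⊆C odd
  open Weights G

lemma6p4 : ∀ {c ℓ₁ ℓ₂} (G : OrderedAbelianGroup c ℓ₁ ℓ₂) →
    let open OrderedAbelianGroup G in
    ∀ {n} (T : Trigraph n) (w : Fin n → Carrier) →
    InF T → ¬ HasBalancedSkewPartition T →
    (∀ v → ε ≤ w v) →
    ∀ (X₁ X₂ A₁ B₁ C₁ A₂ B₂ C₂ : Subset n) →
    IsSplitOfOdd2Join T X₁ X₂ A₁ B₁ C₁ A₂ B₂ C₂ →
    ∀ (αAC αBC αC αX : Carrier) →
    IsAlpha G T w (A₁ ∪ C₁) αAC →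
    IsAlpha G T w (B₁ ∪ C₁) αBC →
    IsAlpha G T w C₁ αC →
    IsAlpha G T w X₁ αX →
    (αC ∙ αX) ≤ (αAC ∙ αBC)
lemma6p4 G T w _ _ _ X₁ _ A₁ B₁ C₁ _ _ _ ((_ , X₁-split , _) , odd₁ , _) αAC αBC αC αX
  (_ , αAC-max) (_ , αBC-max)
  ((S′ , S′⊆C₁ , S′-stable , wS′≈αC) , _) ((S , S⊆X₁ , S-stable , wS≈αX) , _)
  with S₁ , S₂ , (S₁⊆A₁∪C₁ , S₁-stable) , (S₂⊆B₁∪C₁ , S₂-stable) , exchange
         ← odd-side-exchange G T w S-stable S′-stable (λ v → X₁-split v ∘ S⊆X₁) S′⊆C₁ odd₁ =
  begin
    αC ∙ αX                         ≈⟨ ∙-cong wS′≈αC wS≈αX ⟨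
    weight G w S′ ∙ weight G w S    ≈⟨ comm _ _ ⟩
    weight G w S ∙ weight G w S′    ≈⟨ exchange ⟨
    weight G w S₁ ∙ weight G w S₂   ≲⟨ ∙-mono-≤ (αAC-max S₁ S₁⊆A₁∪C₁ S₁-stable)
                                                 (αBC-max S₂ S₂⊆B₁∪C₁ S₂-stable) ⟩
    αAC ∙ αBC                       ∎
  where
  open OrderedAbelianGroup G
  open Weights G using (∙-mono-≤)
  open PreorderReasoning (IsTotalOrder.isPreorder isTotalOrder)
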